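{- For every $n\geq 3$, $B_d^t(P_n)=1$, where $P_n$ is the path on $n$ vertices.
   Context: A total dominator coloring (TD-coloring) of a graph $G$ with no isolated vertex is a proper vertex coloring of $G$ in which every vertex of $G$ is adjacent to every vertex of some (other) color class. The total dominator chromatic (TDC) number $\chi_d^t(G)$ is the minimum number of color classes in a TD-coloring of $G$. The TDC-bondage number $B_d^t(G)$ of $G$ is the minimum number of edges of $G$ whose removal changes the TDC-number of $G$. -}

module Defs where

open import Data.Nat using (ℕ; suc; _≤_; _<_)
open import Data.Fin using (Fin; toℕ)
open import Data.Product using (Σ; _×_; _,_; ∃)
open import Data.Sum using (_⊎_)
open import Data.List using (List; length)
open import Data.List.Membership.Propositional using (_∈_)
open import Data.List.Relation.Unary.All using (All)
open import Data.List.Relation.Unary.Unique.Propositional using (Unique)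
open import Relation.Nullary using (¬_)
open import Relation.Binary.PropositionalEquality using (_≡_; _≢_)

Graph : ℕ → Set₁
Graph n = Fin n → Fin n → Set

Path : (n : ℕ) → Graph n
Path n u v = (toℕ v ≡ suc (toℕ u)) ⊎ (toℕ u ≡ suc (toℕ v))

-- A coloring with (at most) k colors: the color classes are the fibres.
Coloring : ℕ → ℕ → Set
Coloring n k = Fin n → Fin k

Proper : ∀ {n k} → Graph n → Coloring n k → Set
Proper {n} G c = ∀ (u v : Fin n) → G u v → c u ≢ c v

TotalDominator : ∀ {n k} → Graph n → Coloring n k → Set
TotalDominator {n} {k} G c =
  ∀ (v : Fin n) → Σ (Fin k) λ i →
    (∃ λ (w : Fin n) → c w ≡ i) × (∀ (w : Fin n) → c w ≡ i → G v w)

IsTDColoring : ∀ {n k} → Graph n → Coloring n k → Set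
IsTDColoring G c = Proper G c × TotalDominator G c

HasTDColoring : ∀ {n} → Graph n → ℕ → Set
HasTDColoring {n} G k = Σ (Coloring n k) λ c → IsTDColoring G c

-- χ_d^t(G) = k : a TD-coloring with k colors exists and none with fewer.
-- (If G has an isolated vertex, no TD-coloring exists and IsTDC G k
-- holds for no k, i.e. χ_d^t(G) is undefined / "∞".)
IsTDC : ∀ {n} → Graph n → ℕ → Set
IsTDC G k = HasTDColoring G k × (∀ m → HasTDColoring G m → k ≤ m)

Edge : ℕ → Set
Edge n = Fin n × Fin n

IsEdgeSet : ∀ {n} → Graph n → List (Edge n) → Set
IsEdgeSet G F =
  All (λ e → (toℕ (Data.Product.proj₁ e) < toℕ (Data.Product.proj₂ e))
             × G (Data.Product.proj₁ e) (Data.Product.proj₂ e)) F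
  × Unique F

RemoveEdges : ∀ {n} → Graph n → List (Edge n) → Graph n
RemoveEdges G F u v = G u v × ¬ ((u , v) ∈ F) × ¬ ((v , u) ∈ F)

ChangesTDC : ∀ {n} → Graph n → List (Edge n) → Set
ChangesTDC G F = Σ ℕ λ k → IsTDC G k × ¬ IsTDC (RemoveEdges G F) k

IsTDCBondage : ∀ {n} → Graph n → ℕ → Set
IsTDCBondage {n} G b =
  (Σ (List (Edge n)) λ F → IsEdgeSet G F × length F ≡ b × ChangesTDC G F)
  × (∀ (F : List (Edge n)) → IsEdgeSet G F → ChangesTDC G F → b ≤ length F)

-- Deleting the pendant edge {0,1} of P_n leaves vertex 0 isolated, and a graph
-- with an isolated vertex has no TD-coloring at all, so its TDC-number is
-- undefined. The TDC-number of P_n itself is defined: coloring every vertex by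
-- its own name is a TD-coloring, and since TD-colorability with m colors is
-- decidable (finitely many colorings), a least such m exists. Removing no edge
-- leaves the graph unchanged, so a single edge is the minimum.
module Submission where

open import Defs
open import Data.Nat using (ℕ; zero; suc; _≤_; z≤n; s≤s)
open import Data.Fin using (Fin; toℕ; inject₁) renaming (zero to fzero; suc to fsuc)
open import Data.Fin.Properties using (any?; all?; toℕ-inject₁) renaming (_≟_ to _≟ᶠ_)
import Data.Nat.Properties as ℕ
open import Data.Vec.Functional using () renaming (_∷_ to _∷ᵛ_)
open import Data.Product using (Σ; _×_; _,_; ∃; proj₁)
open import Data.Sum using (inj₁; inj₂)
open import Data.List using (List; []; _∷_; [_])
open import Data.List.Relation.Unary.All using () renaming ([] to []ᵃ; _∷_ to _∷ᵃ_)
open import Data.List.Relation.Unary.Any using (here)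
open import Data.List.Membership.Propositional using (_∈_)
open import Data.List.Relation.Unary.AllPairs using () renaming ([] to []ᵖ; _∷_ to _∷ᵖ_)
open import Data.Empty using (⊥-elim)
open import Function using (id)
open import Relation.Nullary using (¬_; Dec; yes; no)
open import Relation.Nullary.Decidable using (_×-dec_; _⊎-dec_; _→-dec_; ¬?)
open import Relation.Binary using (Decidable)
open import Relation.Binary.PropositionalEquality
  using (_≡_; refl; sym; trans; cong; subst; _≗_)

∃-fun? : ∀ n {m} (P : (Fin n → Fin m) → Set) →
         (∀ {c c′} → c ≗ c′ → P c → P c′) → (∀ c → Dec (P c)) →
         Dec (Σ (Fin n → Fin m) P)
∃-fun? zero P resp P? with P? (λ ())
... | yes p = yes (_ , p)
... | no ¬p = no λ { (c , pc) → ¬p (resp (λ ()) pc) }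
∃-fun? (suc n) {m} P resp P?
  with any? {n = m} (λ x → ∃-fun? n (λ c → P (x ∷ᵛ c))
          (λ c≗c′ → resp (λ { fzero → refl ; (fsuc i) → c≗c′ i }))
          (λ c → P? (x ∷ᵛ c)))
... | yes (x , c , pc) = yes (x ∷ᵛ c , pc)
... | no ¬q = no λ { (c , pc) → ¬q (c fzero , (λ i → c (fsuc i)) ,
                       resp (λ { fzero → refl ; (fsuc i) → refl }) pc) }

∃-least : (P : ℕ → Set) → (∀ n → Dec (P n)) → ∀ n → P n →
          Σ ℕ λ k → P k × (∀ m → P m → k ≤ m)
∃-least P P? n p with P? 0
... | yes p₀ = 0 , p₀ , λ _ _ → z≤n
∃-least P P? zero p    | no ¬p₀ = ⊥-elim (¬p₀ p)
∃-least P P? (suc n) p | no ¬p₀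
  with ∃-least (λ m → P (suc m)) (λ m → P? (suc m)) n p
... | k , pk , least = suc k , pk , λ { zero q → ⊥-elim (¬p₀ q)
                                      ; (suc m) q → s≤s (least m q) }

module _ {n : ℕ} where

  isTDColoring? : ∀ {k} {G : Graph n} → Decidable G →
                  (c : Coloring n k) → Dec (IsTDColoring G c)
  isTDColoring? G? c =
    all? (λ u → all? (λ v → G? u v →-dec ¬? (c u ≟ᶠ c v)))
    ×-dec all? (λ v → any? (λ i → any? (λ w → c w ≟ᶠ i)
                                  ×-dec all? (λ w → (c w ≟ᶠ i) →-dec G? v w)))

  IsTDColoring-resp-≗ : ∀ {k} (G : Graph n) {c c′ : Coloring n k} →
                        c ≗ c′ → IsTDColoring G c → IsTDColoring G c′
  IsTDColoring-resp-≗ G c≗c′ (proper , dominated) =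
    (λ u v uv eq → proper u v uv (trans (c≗c′ u) (trans eq (sym (c≗c′ v))))) ,
    λ v → let (i , (w , cw) , all) = dominated v in
      i , (w , trans (sym (c≗c′ w)) cw) , λ w′ cw′ → all w′ (trans (c≗c′ w′) cw′)

  hasTDColoring? : {G : Graph n} → Decidable G → ∀ k → Dec (HasTDColoring G k)
  hasTDColoring? {G} G? k =
    ∃-fun? n (IsTDColoring G) (IsTDColoring-resp-≗ G) (isTDColoring? G?)

  HasTDColoring⇒∃IsTDC : {G : Graph n} → Decidable G →
                         ∀ {k} → HasTDColoring G k → ∃ (IsTDC G)
  HasTDColoring⇒∃IsTDC {G} G? {k} = ∃-least (HasTDColoring G) (hasTDColoring? G?) k

  id-isTDColoring : {G : Graph n} → (∀ v → ¬ G v v) → (∀ v → ∃ (G v)) →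
                    IsTDColoring G id
  id-isTDColoring irrefl neighbour =
    (λ { u .u uu refl → irrefl u uu }) ,
    λ v → let (w , vw) = neighbour v in w , (w , refl) , λ { .w refl → vw }

  isolated⇒¬TotalDominator : ∀ {k} {G : Graph n} {c : Coloring n k} v →
                             (∀ w → ¬ G v w) → ¬ TotalDominator G c
  isolated⇒¬TotalDominator v isolated dominated =
    let (i , (w , cw) , all) = dominated v in isolated w (all w cw)

  IsTDColoring-resp-⇔ : ∀ {k} {G H : Graph n} {c : Coloring n k} →
                        (∀ {u v} → G u v → H u v) → (∀ {u v} → H u v → G u v) →
                        IsTDColoring G c → IsTDColoring H c
  IsTDColoring-resp-⇔ G⇒H H⇒G (proper , dominated) =
    (λ u v uv → proper u v (H⇒G uv)) ,
    λ v → let (i , nonempty , all) = dominated v in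
      i , nonempty , λ w cw → G⇒H (all w cw)

  IsTDC-resp-⇔ : ∀ {k} {G H : Graph n} →
                 (∀ {u v} → G u v → H u v) → (∀ {u v} → H u v → G u v) →
                 IsTDC G k → IsTDC H k
  IsTDC-resp-⇔ G⇒H H⇒G ((c , td) , least) =
    (c , IsTDColoring-resp-⇔ G⇒H H⇒G td) ,
    λ { m (c′ , td′) → least m (c′ , IsTDColoring-resp-⇔ H⇒G G⇒H td′) }

  ¬ChangesTDC-[] : (G : Graph n) → ¬ ChangesTDC G []
  ¬ChangesTDC-[] G (k , tdc , ¬tdc) =
    ¬tdc (IsTDC-resp-⇔ (λ uv → uv , (λ ()) , (λ ())) proj₁ tdc)

  RemoveEdges-isolated : ∀ {G : Graph n} {F : List (Edge n)} {u v} →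
                         (∀ {w} → G v w → w ≡ u) → (v , u) ∈ F →
                         ∀ w → ¬ RemoveEdges G F v w
  RemoveEdges-isolated onlyU vu∈F w (vw , vw∉F , _) =
    vw∉F (subst (λ x → (_ , x) ∈ _) (sym (onlyU vw)) vu∈F)

  isolating-ChangesTDC : ∀ {G : Graph n} {F : List (Edge n)} {k} →
                         Decidable G → HasTDColoring G k →
                         ∀ {u v} → (∀ {w} → G v w → w ≡ u) → (v , u) ∈ F →
                         ChangesTDC G F
  isolating-ChangesTDC {G} G? has onlyU vu∈F =
    let (k , tdc) = HasTDColoring⇒∃IsTDC G? has in
    k , tdc , λ { ((_ , _ , dominated) , _) →
      isolated⇒¬TotalDominator _ (RemoveEdges-isolated {G = G} onlyU vu∈F) dominated }

path? : ∀ {n} → Decidable (Path n)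
path? u v = (toℕ v ℕ.≟ suc (toℕ u)) ⊎-dec (toℕ u ℕ.≟ suc (toℕ v))

path-irrefl : ∀ {n} (v : Fin n) → ¬ Path n v v
path-irrefl v (inj₁ eq) = ℕ.1+n≢n (sym eq)
path-irrefl v (inj₂ eq) = ℕ.1+n≢n (sym eq)

path-neighbour : ∀ {m} (v : Fin (suc (suc m))) → ∃ (Path (suc (suc m)) v)
path-neighbour fzero    = fsuc fzero , inj₁ refl
path-neighbour (fsuc v) = inject₁ v , inj₂ (cong suc (sym (toℕ-inject₁ v)))

path-zero-neighbour : ∀ {m} {w : Fin (suc (suc m))} →
                      Path (suc (suc m)) fzero w → w ≡ fsuc fzero
path-zero-neighbour {w = fzero}         (inj₁ ())
path-zero-neighbour {w = fzero}         (inj₂ ())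
path-zero-neighbour {w = fsuc fzero}    _ = refl
path-zero-neighbour {w = fsuc (fsuc _)} (inj₁ ())
path-zero-neighbour {w = fsuc (fsuc _)} (inj₂ ())

theorem4p8 : ∀ (n : ℕ) → 3 ≤ n → IsTDCBondage (Path n) 1
theorem4p8 n@(suc (suc (suc _))) (s≤s (s≤s (s≤s z≤n))) =
  ([ pendant ] , (((s≤s z≤n , inj₁ refl) ∷ᵃ []ᵃ) , ([]ᵃ ∷ᵖ []ᵖ)) , refl ,
    isolating-ChangesTDC path? (id , id-isTDColoring path-irrefl path-neighbour)
                         path-zero-neighbour (here refl)) ,
  λ { [] _ changes → ⊥-elim (¬ChangesTDC-[] (Path n) changes)
    ; (_ ∷ _) _ _ → s≤s z≤n }
  where
  pendant : Edge n
  pendant = fzero , fsuc fzero
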